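{- Let $\mathfrak{A}\in\mathrm{REL}$ be a perfect algebra and let $a$ be an atom of $\mathfrak{A}$ with $a\le1'$. Then $\breve{a}\neq0$, $st(a)\neq0$, $end(a)\neq0$, and $a=\breve{a}=\mathcal{S}a=\mathcal{E}a$.
   Context: $\mathrm{REL}$ is the class of algebras $\mathfrak{A}=\langle A,+,\cdot,-,0,1,;,\breve{\ },1'\rangle$ (binary $;$, unary converse $x\mapsto\breve{x}$, constant $1'$) satisfying: (Ax1) $\langle A,+,\cdot,-,0,1\rangle$ is a Boolean algebra; (Ax2) $(x\cdot\breve{y})\breve{}=\breve{x}\cdot y$; (Ax3) $(x+y);z=x;z+y;z$ and $x;(y+z)=x;y+x;z$; (Ax4) $1;0=0$ and $0;1=0$; (Ax5) $(\breve{x};y)\cdot z=(\breve{x};(y\cdot(\breve{\breve{x}};z)))\cdot z$ and $(x;\breve{y})\cdot z=((x\cdot(z;\breve{\breve{y}}));\breve{y})\cdot z$; (Ax6) $1';x\le x$ and $x;1'\le x$; (Ax7) $1';1'=1'$; (Ax8) $(-(\breve{1});-(\breve{1}))\cdot 1'=0$; (Ax9) $((x\cdot1');y);z=(x\cdot1');(y;z)$, $(x;(y\cdot1'));z=x;((y\cdot1');z)$ and $(x;y);(z\cdot1')=x;(y;(z\cdot1'))$. An algebra $\mathfrak{A}\in\mathrm{REL}$ is perfect if it is complete and atomic and its converse and composition operations are completely additive. For an atom $a$, $st(a)=1';a$ and $end(a)=a;1'$. In a perfect $\mathfrak{A}\in\mathrm{REL}$: if $st(a)\neq0$, $\mathcal{S}a$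 denotes the unique atom $a^-\le1'$ with $a^-;a=a$; if $end(a)\neq0$, $\mathcal{E}a$ denotes the unique atom $a^-\le1'$ with $a;a^-=a$ (these exist and are unique). -}

module Defs where

open import Level using (Level; suc)
open import Data.Product using (Σ; ∃; _×_; _,_)
open import Data.Sum using (_⊎_)
open import Relation.Nullary using (¬_)
open import Relation.Unary using (Pred)
open import Relation.Binary.PropositionalEquality using (_≡_)
import Algebra.Lattice.Structures as LS


record REL (c : Level) : Set (suc c) where
  field
    Carrier : Set c
    _+_ _·_ _⨾_ : Carrier → Carrier → Carrier
    -_ _˘ : Carrier → Carrier
    𝟘 𝟙 𝟙' : Carrier
  infixr 6 _+_
  infixr 7 _·_
  infixr 8 _⨾_
  infix 9 _˘
  field
    isBooleanAlgebra : LS.IsBooleanAlgebra (_≡_ {A = Carrier}) _+_ _·_ -_ 𝟙 𝟘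
    ax2 : ∀ x y → ((x · (y ˘)) ˘) ≡ (x ˘) · y
    ax3ʳ : ∀ x y z → (x + y) ⨾ z ≡ x ⨾ z + y ⨾ z
    ax3ˡ : ∀ x y z → x ⨾ (y + z) ≡ x ⨾ y + x ⨾ z
    ax4ˡ : 𝟙 ⨾ 𝟘 ≡ 𝟘
    ax4ʳ : 𝟘 ⨾ 𝟙 ≡ 𝟘
    ax5ˡ : ∀ x y z → ((x ˘) ⨾ y) · z ≡ ((x ˘) ⨾ (y · (((x ˘) ˘) ⨾ z))) · z
    ax5ʳ : ∀ x y z → (x ⨾ (y ˘)) · z ≡ ((x · (z ⨾ ((y ˘) ˘))) ⨾ (y ˘)) · z
    -- Ax6 (x ≤ y written as x + y ≡ y)
    ax6ˡ : ∀ x → 𝟙' ⨾ x + x ≡ x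
    ax6ʳ : ∀ x → x ⨾ 𝟙' + x ≡ x
    ax7 : 𝟙' ⨾ 𝟙' ≡ 𝟙'
    ax8 : ((- (𝟙 ˘)) ⨾ (- (𝟙 ˘))) · 𝟙' ≡ 𝟘
    ax9a : ∀ x y z → ((x · 𝟙') ⨾ y) ⨾ z ≡ (x · 𝟙') ⨾ (y ⨾ z)
    ax9b : ∀ x y z → (x ⨾ (y · 𝟙')) ⨾ z ≡ x ⨾ ((y · 𝟙') ⨾ z)
    ax9c : ∀ x y z → (x ⨾ y) ⨾ (z · 𝟙') ≡ x ⨾ (y ⨾ (z · 𝟙'))

module RELNotions {c : Level} (𝔄 : REL c) where
  open REL 𝔄

  infix 4 _≤_
  _≤_ : Carrier → Carrier → Set c
  x ≤ y = x + y ≡ y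

  IsAtom : Carrier → Set c
  IsAtom a = ¬ (a ≡ 𝟘) × (∀ b → b ≤ a → b ≡ 𝟘 ⊎ b ≡ a)

  IsSup : Pred Carrier c → Carrier → Set c
  IsSup P s = (∀ x → P x → x ≤ s) × (∀ u → (∀ x → P x → x ≤ u) → s ≤ u)

  Image : (Carrier → Carrier) → Pred Carrier c → Pred Carrier c
  Image f P z = ∃ λ x → P x × z ≡ f x

  Complete : Set (suc c)
  Complete = ∀ (P : Pred Carrier c) → ∃ λ s → IsSup P s

  Atomic : Set c
  Atomic = ∀ x → ¬ (x ≡ 𝟘) → ∃ λ a → IsAtom a × a ≤ x

  CompletelyAdditive₁ : (Carrier → Carrier) → Set (suc c)
  CompletelyAdditive₁ f = ∀ (P : Pred Carrier c) s → IsSup P s → IsSup (Image f P) (f s)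

  Perfect : Set (suc c)
  Perfect = Complete × Atomic
          × CompletelyAdditive₁ _˘
          × (∀ y → CompletelyAdditive₁ (λ x → x ⨾ y))
          × (∀ y → CompletelyAdditive₁ (λ x → y ⨾ x))

  st end : Carrier → Carrier
  st a = 𝟙' ⨾ a
  end a = a ⨾ 𝟙'

  IsSAtom : Carrier → Carrier → Set c
  IsSAtom a b = IsAtom b × b ≤ 𝟙' × b ⨾ a ≡ a

  IsEAtom : Carrier → Carrier → Set c
  IsEAtom a b = IsAtom b × b ≤ 𝟙' × a ⨾ b ≡ a

  -- "x = 𝒮a": x is the unique atom b ≤ 1' with b ⨾ a = a
  IsS : Carrier → Carrier → Set c
  IsS a x = IsSAtom a x × (∀ b → IsSAtom a b → b ≡ x)

  -- "x = ℰa": x is the unique atom b ≤ 1' with a ⨾ b = a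
  IsE : Carrier → Carrier → Set c
  IsE a x = IsEAtom a x × (∀ b → IsEAtom a b → b ≡ x)

-- A subidentity p ≤ 1' splits 1' into p and its relative complement q = 1' · -p; the cross
-- products p ⨾ q and q ⨾ p vanish, so Ax7 yields 1' = p ⨾ p + q ⨾ q and hence p ⨾ p = p,
-- which gives st p = end p = p. Ax8 then forces p ≤ 1˘, so p˘˘ = p, and Ax5 instantiated at
-- p˘ gives p ≤ p˘. For an atom a the meet a · (-a)˘ is 0 or a, and the second case would
-- put a below -a; so a˘ ≤ a. Finally, an atom b ≤ 1' with b ⨾ a = a lies above a, hence
-- equals it.
module Submission where

open import Defs
open import Level using (Level)
open import Data.Product using (_×_; _,_; proj₁; proj₂)
open import Data.Sum using (inj₁; inj₂)
open import Data.Empty using (⊥-elim)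
open import Relation.Nullary using (¬_)
open import Relation.Binary.PropositionalEquality
open import Algebra.Lattice.Bundles using (BooleanAlgebra)
import Algebra.Lattice.Properties.BooleanAlgebra as BooleanAlgebraProperties
import Algebra.Lattice.Properties.Lattice as LatticeProperties
import Relation.Binary.Lattice.Bundles as OrderTheoretic
import Algebra.Lattice.Structures as LS

module RELProperties {c : Level} (𝔄 : REL c) where
  open REL 𝔄
  open RELNotions 𝔄
  open ≡-Reasoning

  booleanAlgebra : BooleanAlgebra c c
  booleanAlgebra = record { isBooleanAlgebra = isBooleanAlgebra }

  open BooleanAlgebra booleanAlgebra using (lattice)
  open LS.IsBooleanAlgebra isBooleanAlgebra using
    (∨-comm; ∧-comm; ∨-absorbs-∧; ∧-absorbs-∨;
     ∨-complementʳ; ∧-complementʳ; ∧-distribˡ-∨; ∨-distribˡ-∧)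
  open BooleanAlgebraProperties booleanAlgebra using
    (∧-identityʳ; ∧-identityˡ; ∨-identityʳ; ∨-identityˡ; ∨-zeroʳ; ∧-zeroˡ; ∧-zeroʳ)

  -- The library orders a lattice by x ≈ x ∧ y, whereas _≤_ is x + y ≡ y.
  private
    module Order = OrderTheoretic.Lattice (LatticeProperties.∨-∧-orderTheoreticLattice lattice)

    ≤⇒≤ₒ : ∀ {x y} → x ≤ y → x Order.≤ y
    ≤⇒≤ₒ {x} {y} x+y≡y = sym (trans (cong (x ·_) (sym x+y≡y)) (∧-absorbs-∨ x y))

    ≤ₒ⇒≤ : ∀ {x y} → x Order.≤ y → x ≤ y
    ≤ₒ⇒≤ {x} {y} x≡x·y = begin
      x + y         ≡⟨ cong (_+ y) x≡x·y ⟩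
      x · y + y     ≡⟨ ∨-comm (x · y) y ⟩
      y + x · y     ≡⟨ cong (y +_) (∧-comm x y) ⟩
      y + y · x     ≡⟨ ∨-absorbs-∧ y x ⟩
      y             ∎

  ≤-refl : ∀ {x} → x ≤ x
  ≤-refl = ≤ₒ⇒≤ Order.refl

  ≤-trans : ∀ {x y z} → x ≤ y → y ≤ z → x ≤ z
  ≤-trans p q = ≤ₒ⇒≤ (Order.trans (≤⇒≤ₒ p) (≤⇒≤ₒ q))

  ≤-antisym : ∀ {x y} → x ≤ y → y ≤ x → x ≡ y
  ≤-antisym p q = Order.antisym (≤⇒≤ₒ p) (≤⇒≤ₒ q)

  ≤-respʳ-≡ : ∀ {x y z} → y ≡ z → x ≤ y → x ≤ z
  ≤-respʳ-≡ refl p = p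

  x·y≤x : ∀ x y → x · y ≤ x
  x·y≤x x y = ≤ₒ⇒≤ (Order.x∧y≤x x y)

  x·y≤y : ∀ x y → x · y ≤ y
  x·y≤y x y = ≤ₒ⇒≤ (Order.x∧y≤y x y)

  ·-greatest : ∀ {x y z} → x ≤ y → x ≤ z → x ≤ y · z
  ·-greatest p q = ≤ₒ⇒≤ (Order.∧-greatest (≤⇒≤ₒ p) (≤⇒≤ₒ q))

  ≤⇒·≡ : ∀ {x y} → x ≤ y → x · y ≡ x
  ≤⇒·≡ p = sym (≤⇒≤ₒ p)

  x≤𝟙 : ∀ x → x ≤ 𝟙
  x≤𝟙 = ∨-zeroʳ

  x≤𝟘⇒x≡𝟘 : ∀ {x} → x ≤ 𝟘 → x ≡ 𝟘
  x≤𝟘⇒x≡𝟘 {x} p = trans (sym (∨-identityʳ x)) p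

  x·-y≡𝟘⇒x≤y : ∀ {x y} → x · - y ≡ 𝟘 → x ≤ y
  x·-y≡𝟘⇒x≤y {x} {y} e = ≤ₒ⇒≤ (begin
    x                   ≡⟨ sym (∧-identityʳ x) ⟩
    x · 𝟙               ≡⟨ cong (x ·_) (sym (∨-complementʳ y)) ⟩
    x · (y + - y)       ≡⟨ ∧-distribˡ-∨ x y (- y) ⟩
    x · y + x · - y     ≡⟨ cong (x · y +_) e ⟩
    x · y + 𝟘           ≡⟨ ∨-identityʳ (x · y) ⟩
    x · y               ∎)

  disjoint-lower-bound : ∀ {x y z} → x ≤ y → x ≤ z → y · z ≡ 𝟘 → x ≡ 𝟘
  disjoint-lower-bound p q y·z≡𝟘 = x≤𝟘⇒x≡𝟘 (≤-respʳ-≡ y·z≡𝟘 (·-greatest p q))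

  x≤-x⇒x≡𝟘 : ∀ {x} → x ≤ - x → x ≡ 𝟘
  x≤-x⇒x≡𝟘 {x} p = disjoint-lower-bound ≤-refl p (∧-complementʳ x)

  ⨾-monoˡ-≤ : ∀ {x y} z → x ≤ y → x ⨾ z ≤ y ⨾ z
  ⨾-monoˡ-≤ {x} {y} z p = trans (sym (ax3ʳ x y z)) (cong (_⨾ z) p)

  ⨾-monoʳ-≤ : ∀ {x y} z → x ≤ y → z ⨾ x ≤ z ⨾ y
  ⨾-monoʳ-≤ {x} {y} z p = trans (sym (ax3ˡ z x y)) (cong (z ⨾_) p)

  ⨾-mono-≤ : ∀ {x y u v} → x ≤ y → u ≤ v → x ⨾ u ≤ y ⨾ v
  ⨾-mono-≤ {y = y} {u = u} p q = ≤-trans (⨾-monoˡ-≤ u p) (⨾-monoʳ-≤ y q)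

  ⨾-zeroʳ : ∀ x → x ⨾ 𝟘 ≡ 𝟘
  ⨾-zeroʳ x = x≤𝟘⇒x≡𝟘 (≤-respʳ-≡ ax4ˡ (⨾-monoˡ-≤ 𝟘 (x≤𝟙 x)))

  ˘-zero : 𝟘 ˘ ≡ 𝟘
  ˘-zero = begin
    𝟘 ˘             ≡⟨ cong _˘ (sym (∧-zeroˡ (𝟘 ˘))) ⟩
    (𝟘 · 𝟘 ˘) ˘     ≡⟨ ax2 𝟘 𝟘 ⟩
    𝟘 ˘ · 𝟘         ≡⟨ ∧-zeroʳ (𝟘 ˘) ⟩
    𝟘               ∎

  x˘˘≡𝟙˘·x : ∀ x → (x ˘) ˘ ≡ 𝟙 ˘ · x
  x˘˘≡𝟙˘·x x = trans (cong _˘ (sym (∧-identityˡ (x ˘)))) (ax2 𝟙 x)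

  x⨾p≤x : ∀ {p} x → p ≤ 𝟙' → x ⨾ p ≤ x
  x⨾p≤x x p≤𝟙' = ≤-trans (⨾-monoʳ-≤ x p≤𝟙') (ax6ʳ x)

  p⨾x≤x : ∀ {p} x → p ≤ 𝟙' → p ⨾ x ≤ x
  p⨾x≤x x p≤𝟙' = ≤-trans (⨾-monoˡ-≤ x p≤𝟙') (ax6ˡ x)

  disjoint-subid-⨾≡𝟘 : ∀ {p q} → p ≤ 𝟙' → q ≤ 𝟙' → p · q ≡ 𝟘 → p ⨾ q ≡ 𝟘
  disjoint-subid-⨾≡𝟘 {p} {q} p≤𝟙' q≤𝟙' =
    disjoint-lower-bound (x⨾p≤x p q≤𝟙') (p⨾x≤x q p≤𝟙')

  subid-⨾-idem : ∀ {p} → p ≤ 𝟙' → p ⨾ p ≡ p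
  subid-⨾-idem {p} p≤𝟙' = ≤-antisym (x⨾p≤x p p≤𝟙') p≤p⨾p
    where
    q : Carrier
    q = 𝟙' · - p

    q≤𝟙' : q ≤ 𝟙'
    q≤𝟙' = x·y≤x 𝟙' (- p)

    p·q≡𝟘 : p · q ≡ 𝟘
    p·q≡𝟘 = disjoint-lower-bound (x·y≤x p q) (≤-trans (x·y≤y p q) (x·y≤y 𝟙' (- p)))
                                 (∧-complementʳ p)

    q·p≡𝟘 : q · p ≡ 𝟘
    q·p≡𝟘 = trans (∧-comm q p) p·q≡𝟘

    𝟙'≡p+q : 𝟙' ≡ p + q
    𝟙'≡p+q = sym (begin
      p + 𝟙' · - p              ≡⟨ ∨-distribˡ-∧ p 𝟙' (- p) ⟩
      (p + 𝟙') · (p + - p)      ≡⟨ cong₂ _·_ p≤𝟙' (∨-complementʳ p) ⟩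
      𝟙' · 𝟙                    ≡⟨ ∧-identityʳ 𝟙' ⟩
      𝟙'                        ∎)

    𝟙'≡p⨾p+q⨾q : 𝟙' ≡ p ⨾ p + q ⨾ q
    𝟙'≡p⨾p+q⨾q = begin
      𝟙'                                    ≡⟨ sym ax7 ⟩
      𝟙' ⨾ 𝟙'                               ≡⟨ cong₂ _⨾_ 𝟙'≡p+q 𝟙'≡p+q ⟩
      (p + q) ⨾ (p + q)                     ≡⟨ ax3ʳ p q (p + q) ⟩
      p ⨾ (p + q) + q ⨾ (p + q)             ≡⟨ cong₂ _+_ (ax3ˡ p p q) (ax3ˡ q p q) ⟩
      (p ⨾ p + p ⨾ q) + (q ⨾ p + q ⨾ q)     ≡⟨ cong₂ (λ u v → (p ⨾ p + u) + (v + q ⨾ q))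
                                                 (disjoint-subid-⨾≡𝟘 p≤𝟙' q≤𝟙' p·q≡𝟘)
                                                 (disjoint-subid-⨾≡𝟘 q≤𝟙' p≤𝟙' q·p≡𝟘) ⟩
      (p ⨾ p + 𝟘) + (𝟘 + q ⨾ q)             ≡⟨ cong₂ _+_ (∨-identityʳ (p ⨾ p)) (∨-identityˡ (q ⨾ q)) ⟩
      p ⨾ p + q ⨾ q                         ∎

    p·q⨾q≡𝟘 : p · (q ⨾ q) ≡ 𝟘
    p·q⨾q≡𝟘 = disjoint-lower-bound (x·y≤x p (q ⨾ q))
                (≤-trans (x·y≤y p (q ⨾ q)) (x⨾p≤x q q≤𝟙')) p·q≡𝟘

    p≤p⨾p : p ≤ p ⨾ p
    p≤p⨾p = ≤ₒ⇒≤ (sym (begin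
      p · (p ⨾ p)                       ≡⟨ sym (∨-identityʳ (p · (p ⨾ p))) ⟩
      p · (p ⨾ p) + 𝟘                   ≡⟨ cong (p · (p ⨾ p) +_) (sym p·q⨾q≡𝟘) ⟩
      p · (p ⨾ p) + p · (q ⨾ q)         ≡⟨ sym (∧-distribˡ-∨ p (p ⨾ p) (q ⨾ q)) ⟩
      p · (p ⨾ p + q ⨾ q)               ≡⟨ cong (p ·_) (sym 𝟙'≡p⨾p+q⨾q) ⟩
      p · 𝟙'                            ≡⟨ ≤⇒·≡ p≤𝟙' ⟩
      p                                 ∎))

  subid⇒st≡ : ∀ {p} → p ≤ 𝟙' → st p ≡ p
  subid⇒st≡ {p} p≤𝟙' = ≤-antisym (ax6ˡ p)
    (subst (_≤ st p) (subid-⨾-idem p≤𝟙') (⨾-monoˡ-≤ p p≤𝟙'))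

  subid⇒end≡ : ∀ {p} → p ≤ 𝟙' → end p ≡ p
  subid⇒end≡ {p} p≤𝟙' = ≤-antisym (ax6ʳ p)
    (subst (_≤ end p) (subid-⨾-idem p≤𝟙') (⨾-monoʳ-≤ p p≤𝟙'))

  -- The part q of p outside 1˘ is a subidentity with q = q ⨾ q ≤ -(1˘) ⨾ -(1˘), so Ax8 kills it.
  subid≤𝟙˘ : ∀ {p} → p ≤ 𝟙' → p ≤ 𝟙 ˘
  subid≤𝟙˘ {p} p≤𝟙' = x·-y≡𝟘⇒x≤y (x≤𝟘⇒x≡𝟘 (≤-respʳ-≡ ax8 (·-greatest q≤ q≤𝟙')))
    where
    q : Carrier
    q = p · - (𝟙 ˘)

    q≤𝟙' : q ≤ 𝟙'
    q≤𝟙' = ≤-trans (x·y≤x p (- (𝟙 ˘))) p≤𝟙'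

    q≤ : q ≤ (- (𝟙 ˘)) ⨾ (- (𝟙 ˘))
    q≤ = subst (_≤ _) (subid-⨾-idem q≤𝟙') (⨾-mono-≤ (x·y≤y p _) (x·y≤y p _))

  subid-˘˘ : ∀ {p} → p ≤ 𝟙' → (p ˘) ˘ ≡ p
  subid-˘˘ {p} p≤𝟙' = trans (x˘˘≡𝟙˘·x p) (trans (∧-comm (𝟙 ˘) p) (≤⇒·≡ (subid≤𝟙˘ p≤𝟙')))

  subid≤˘ : ∀ {p} → p ≤ 𝟙' → p ≤ p ˘
  subid≤˘ {p} p≤𝟙' =
    ≤-trans p≤p⨾[p·p˘⨾p] (≤-trans (p⨾x≤x _ p≤𝟙') (≤-trans (x·y≤y p _) (x⨾p≤x (p ˘) p≤𝟙')))
    where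
    ax5-at-p˘ : (p ⨾ p) · p ≡ (p ⨾ (p · ((p ˘) ⨾ p))) · p
    ax5-at-p˘ = subst (λ t → (t ⨾ p) · p ≡ (t ⨾ (p · ((t ˘) ⨾ p))) · p)
                      (subid-˘˘ p≤𝟙') (ax5ˡ (p ˘) p p)

    p≤p⨾[p·p˘⨾p] : p ≤ p ⨾ (p · ((p ˘) ⨾ p))
    p≤p⨾[p·p˘⨾p] = ≤ₒ⇒≤ (begin
      p                                   ≡⟨ sym (≤⇒·≡ ≤-refl) ⟩
      p · p                               ≡⟨ cong (_· p) (sym (subid-⨾-idem p≤𝟙')) ⟩
      (p ⨾ p) · p                         ≡⟨ ax5-at-p˘ ⟩
      (p ⨾ (p · ((p ˘) ⨾ p))) · p         ≡⟨ ∧-comm _ p ⟩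
      p · (p ⨾ (p · ((p ˘) ⨾ p)))         ∎)

  atom-≤-≡ : ∀ {a b} → ¬ a ≡ 𝟘 → IsAtom b → a ≤ b → a ≡ b
  atom-≤-≡ a≢𝟘 (_ , below-b) a≤b with below-b _ a≤b
  ... | inj₁ a≡𝟘 = ⊥-elim (a≢𝟘 a≡𝟘)
  ... | inj₂ a≡b = a≡b

  subid-atom-˘≤ : ∀ {a} → IsAtom a → a ≤ 𝟙' → a ˘ ≤ a
  subid-atom-˘≤ {a} (a≢𝟘 , below-a) a≤𝟙' with below-a (a · (- a) ˘) (x·y≤x a _)
  ... | inj₁ b≡𝟘 = x·-y≡𝟘⇒x≤y (begin
        a ˘ · - a               ≡⟨ sym (ax2 a (- a)) ⟩
        (a · (- a) ˘) ˘         ≡⟨ cong _˘ b≡𝟘 ⟩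
        𝟘 ˘                     ≡⟨ ˘-zero ⟩
        𝟘                       ∎)
  ... | inj₂ b≡a = ⊥-elim (a≢𝟘 (x≤-x⇒x≡𝟘 (≤-trans (subid≤˘ a≤𝟙') a˘≤-a)))
    where
    a˘≤-a : a ˘ ≤ - a
    a˘≤-a = subst (_≤ - a) (trans (sym (ax2 a (- a))) (cong _˘ b≡a)) (x·y≤y (a ˘) (- a))

  subid-atom⇒IsS : ∀ {a} → IsAtom a → a ≤ 𝟙' → IsS a a
  subid-atom⇒IsS {a} a-atom a≤𝟙' =
    (a-atom , a≤𝟙' , subid-⨾-idem a≤𝟙') , λ b (b-atom , _ , b⨾a≡a) →
    sym (atom-≤-≡ (proj₁ a-atom) b-atom (subst (_≤ b) b⨾a≡a (x⨾p≤x b a≤𝟙')))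

  subid-atom⇒IsE : ∀ {a} → IsAtom a → a ≤ 𝟙' → IsE a a
  subid-atom⇒IsE {a} a-atom a≤𝟙' =
    (a-atom , a≤𝟙' , subid-⨾-idem a≤𝟙') , λ b (b-atom , _ , a⨾b≡a) →
    sym (atom-≤-≡ (proj₁ a-atom) b-atom (subst (_≤ b) a⨾b≡a (p⨾x≤x b a≤𝟙')))

lemma2p5 : ∀ {c : Level} (𝔄 : REL c) → let open REL 𝔄 in let open RELNotions 𝔄 in
    Perfect → ∀ a → IsAtom a → a ≤ 𝟙' →
      ¬ ((a ˘) ≡ 𝟘) × ¬ (st a ≡ 𝟘) × ¬ (end a ≡ 𝟘)
        × a ≡ (a ˘) × IsS a a × IsE a a
lemma2p5 𝔄 _ a a-atom a≤𝟙' =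
  (λ a˘≡𝟘 → a≢𝟘 (trans a≡a˘ a˘≡𝟘)) ,
  (λ st≡𝟘 → a≢𝟘 (trans (sym (subid⇒st≡ a≤𝟙')) st≡𝟘)) ,
  (λ end≡𝟘 → a≢𝟘 (trans (sym (subid⇒end≡ a≤𝟙')) end≡𝟘)) ,
  a≡a˘ , subid-atom⇒IsS a-atom a≤𝟙' , subid-atom⇒IsE a-atom a≤𝟙'
  where
  open REL 𝔄
  open RELProperties 𝔄

  a≢𝟘 : ¬ a ≡ 𝟘
  a≢𝟘 = proj₁ a-atom

  a≡a˘ : a ≡ a ˘
  a≡a˘ = ≤-antisym (subid≤˘ a≤𝟙') (subid-atom-˘≤ a-atom a≤𝟙')
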